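{- In $\mathsf{IdCox}_\beta(\overleftarrow{S}_n)$, \[ \prod_{i=-\infty}^{n-1} A^{(\beta)}_i(x_i) = \prod_{j=-\infty}^0 \prod_{i=-\infty}^{n-1} h^{(\beta)}_i(x_{i+j}). \]
   Context: Fix $n\ge1$; let $R$ be a commutative ring containing $\mathbb{Z}[[x_i:i<n]]$ (commuting indeterminates $x_i$) and fix $\beta\in R$. Let $s_i=(i,i+1)$ and $\overleftarrow{S}_n=\langle s_i:i<n\rangle$, the Coxeter group of permutations $w$ of $\mathbb{Z}$ with $w(i)=i$ for $i>n$ that move finitely many integers, with length function $\ell$. The id-Coxeter algebra $\mathsf{IdCox}_\beta(\overleftarrow{S}_n)$ consists of formal $R$-linear combinations of symbols $\pi_w$ ($w\in\overleftarrow{S}_n$), with $R$-bilinear multiplication determined by $\pi_v\pi_w=\pi_{vw}$ if $\ell(vw)=\ell(v)+\ell(w)$ and $\pi_{s}^2=\beta\pi_s$ for simple $s$. Write $\pi_i=\pi_{s_i}$, $h^{(\beta)}_i(x)=1+x\pi_i$ and $A^{(\beta)}_i(x)=h^{(\beta)}_{n-1}(x)h^{(\beta)}_{n-2}(x)\cdots h^{(\beta)}_i(x)$ for $i<n$. Products are ordered with increasing index from left to right; a product $\prod_{i=-\infty}^{m}F_i$ means $\cdots F_{m-2}F_{m-1}F_m$, i.e. the limit as $N\to\infty$ of $F_{ -N}\cdots F_m$, taken coefficientwise in the formal power series topology. -}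

module Defs where

open import Level using (Level)
open import Algebra.Bundles using (CommutativeRing)
open import Data.Bool using (Bool; true; false; if_then_else_; _∧_)
open import Data.Nat as ℕ using (ℕ; zero; suc)
open import Data.Integer as ℤ using (ℤ; +_; -_; _+_; _-_)
open import Data.List using (List; []; _∷_; _++_; [_]; map; foldr; foldl; concatMap; reverse)
open import Data.List.Properties using (≡-dec)
open import Data.Product using (_×_; _,_)
open import Relation.Nullary using (does)
open import Data.Integer.Properties using (≤-decTotalOrder)
open import Data.List.Sort.InsertionSort.Base ≤-decTotalOrder using (sort)

-- Elements of the group  S_n (left)  : permutations of ℤ given by words.
-- A word  (i₁ ∷ i₂ ∷ … ∷ iₖ ∷ [])  denotes  s_{i₁} s_{i₂} ⋯ s_{iₖ}.

sᵢ : ℤ → ℤ → ℤ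
sᵢ i j = if does (j ℤ.≟ i) then i + + 1
         else if does (j ℤ.≟ (i + + 1)) then i else j

⟦_⟧ : List ℤ → ℤ → ℤ
⟦ [] ⟧ j = j
⟦ i ∷ ws ⟧ j = sᵢ i (⟦ ws ⟧ j)

range : ℤ → ℕ → List ℤ
range a zero = []
range a (suc k) = a ∷ range (a + + 1) k

interval : ℤ → ℤ → List ℤ
interval a b = if does (a ℤ.≤? b) then range a (suc ℤ.∣ b - a ∣) else []

minList : ℤ → List ℤ → ℤ
minList a xs = foldr ℤ._⊓_ a xs

-- Equality of the permutations denoted by two words whose letters are
-- all < n.  Such permutations fix every j > n and every j < (min letter),
-- so they are equal iff they agree on the window [min(0,letters), n].
allB : {A : Set} → (A → Bool) → List A → Bool
allB p = foldr (λ x b → p x ∧ b) true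

samePerm : ℕ → List ℤ → List ℤ → Bool
samePerm n u v =
  allB (λ j → does (⟦ u ⟧ j ℤ.≟ ⟦ v ⟧ j)) (interval (minList (+ 0) (u ++ v)) (+ n))

-- Monomials in the variables x_i (i ∈ ℤ) are represented by the finite
-- multiset of their variable indices (a list, compared up to order).
sameMono : List ℤ → List ℤ → Bool
sameMono a b = does (≡-dec ℤ._≟_ (sort a) (sort b))

module IdCox {c ℓ : Level} (R : CommutativeRing c ℓ) (β : CommutativeRing.Carrier R) (n : ℕ) where
  open CommutativeRing R using (Carrier; 1#; 0#) renaming (_+_ to _+ᴿ_; _*_ to _*ᴿ_)

  -- a term  c · x^mono · π_w   (w given by a word)
  record Term : Set c where
    constructor term
    field
      coef : Carrier
      mono : List ℤ
      word : List ℤ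
  open Term public

  Elem : Set c
  Elem = List Term

  one : Elem
  one = term 1# [] [] ∷ []

  -- right multiplication of a term by  x_k π_i :
  --   π_w π_i = π_{w s_i}  if  ℓ(w s_i) = ℓ(w) + 1  (i.e. w(i) < w(i+1)),
  --   π_w π_i = β π_w      otherwise  (then w = w' s_i, π_w π_i = π_{w'} π_i² ).
  termTimes : ℤ → ℤ → Term → Term
  termTimes i k (term a m w) =
    if does (⟦ w ⟧ i ℤ.<? ⟦ w ⟧ (i + + 1))
    then term a (k ∷ m) (w ++ [ i ])
    else term (β *ᴿ a) (k ∷ m) w

  -- E · h_i(x_k) = E · (1 + x_k π_i)
  timesH : Elem → ℤ × ℤ → Elem
  timesH E (i , k) = E ++ map (termTimes i k) E

  prodH : List (ℤ × ℤ) → Elem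
  prodH fs = foldl timesH one fs

  coeff : List ℤ → List ℤ → Elem → Carrier
  coeff m w E = foldr (λ t acc → if sameMono (mono t) m ∧ samePerm n (word t) w
                                 then coef t +ᴿ acc else acc) 0# E

  -- h-factor list of  A_a(x_a) = h_{n-1}(x_a) h_{n-2}(x_a) ⋯ h_a(x_a)
  factorsA : ℤ → List (ℤ × ℤ)
  factorsA a = map (λ i → (i , a)) (reverse (interval a (+ n - + 1)))

  -- truncation  A_{-N}(x_{-N}) A_{-N+1}(x_{-N+1}) ⋯ A_{n-1}(x_{n-1})
  lhs : ℕ → Elem
  lhs N = prodH (concatMap factorsA (interval (- + N) (+ n - + 1)))

  -- truncation  ∏_{j=-N}^{0} ∏_{i=-N}^{n-1} h_i(x_{i+j})
  rhs : ℕ → Elem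
  rhs N = prodH (concatMap (λ j → map (λ i → (i , i + j)) (interval (- + N) (+ n - + 1)))
                           (interval (- + N) (+ 0)))

{-# OPTIONS --safe #-}
module Submission where

open import Defs
open import Algebra.Bundles using (CommutativeRing)
open import Data.Nat using (ℕ; _≤_)
open import Data.Integer using (ℤ; +_) renaming (_<_ to _<ℤ_)
open import Data.List using (List)
open import Data.List.Relation.Unary.All using (All)
open import Data.Product using (∃)

open import Data.Bool using (Bool; true; false; if_then_else_; _∧_)
open import Data.Integer as ℤ using (-_; _+_; _-_; _⊓_; ∣_∣)
import Data.Integer.Properties as ℤ
open import Data.Integer.Tactic.RingSolver using (solve-∀)
open import Data.List using ([]; _∷_; _++_; [_]; map; foldr; foldl; concatMap; reverse)
open import Data.List.Extrema ℤ.≤-totalOrder using (min; min≤xs)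
open import Data.List.Membership.Propositional using (_∈_; _∉_)
import Data.List.Properties as List
open import Data.List.Properties using (≡-dec)
open import Data.List.Relation.Binary.Permutation.Propositional using (↭-sym)
open import Data.List.Relation.Binary.Permutation.Propositional.Properties using (∈-resp-↭)
open import Data.List.Relation.Binary.Pointwise using (Pointwise-≡⇒≡)
open import Data.List.Relation.Unary.All using ([]; _∷_)
import Data.List.Relation.Unary.All as All
import Data.List.Relation.Unary.All.Properties as All
open import Data.List.Relation.Unary.Any using (here; there)
open import Data.List.Sort.InsertionSort.Base ℤ.≤-decTotalOrder using (insert; sort)
open import Data.List.Sort.InsertionSort.Properties ℤ.≤-decTotalOrder using (sort-↭; insert-swap)
open import Data.Nat as ℕ using (zero; suc; s≤s; z≤n)
import Data.Nat.Properties as ℕ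
open import Data.Product using (_×_; _,_; proj₁; proj₂)
open import Data.Sum using (_⊎_; inj₁; inj₂)
open import Function using (_on_)
open import Level using (_⊔_)
open import Relation.Binary.Construct.Closure.Equivalence as EqClosure using (EqClosure)
open import Relation.Binary.Construct.Closure.ReflexiveTransitive using (ε; _◅_; _◅◅_)
open import Relation.Binary.Construct.Closure.Symmetric using (fwd)
open import Relation.Binary.PropositionalEquality
  using (_≡_; _≢_; _≗_; refl; sym; trans; cong; cong₂; subst; subst₂; module ≡-Reasoning)
open import Relation.Binary.Structures using (IsEquivalence)
open import Relation.Nullary using (does; yes; no)
open import Relation.Nullary.Decidable using (dec-true; dec-false)

-- Expanding an ordered product of factors h_i(x_k) = 1 + x_k π_i term by term, the
-- coefficient of x^m π_w is unchanged by two operations: deleting a factor whose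
-- variable x_k does not occur in m (every term through its x_k π_i part has the wrong
-- monomial), and swapping adjacent factors h_i, h_{i'} with |i − i'| ≥ 2 (then s_i and
-- s_{i'} commute, so π_i π_{i'} = π_{i'} π_i).  Once N is so large that all variables
-- of m are at least B = n − 1 − N, deleting the factors in variables below B leaves of
-- both truncations the triangle of factors h_{B+s}(x_{B+r}), 0 ≤ r ≤ s ≤ N: the left
-- side reads it column by column (r increasing, s decreasing), the right side diagonal
-- by diagonal (s − r decreasing, r increasing).  Both readings keep the relative order
-- of any two factors whose rows s differ by at most one, so they differ by swaps of
-- commuting factors only.

+-pos-+ : ∀ a p q → a + + p + + q ≡ a + + (p ℕ.+ q)
+-pos-+ a p q = trans (ℤ.+-assoc a (+ p) (+ q)) (cong (_+_ a) (sym (ℤ.pos-+ p q)))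

range-++ : ∀ a p q → range a (p ℕ.+ q) ≡ range a p ++ range (a + + p) q
range-++ a zero    q = cong (λ b → range b q) (sym (ℤ.+-identityʳ a))
range-++ a (suc p) q = cong (a ∷_) (trans (range-++ (a + + 1) p q)
  (cong (λ b → range (a + + 1) p ++ range b q) (+-pos-+ a 1 p)))

+-pos-suc : ∀ a k → a + + k + + 1 ≡ a + + suc k
+-pos-suc a k = trans (+-pos-+ a k 1) (cong (λ x → a + + x) (ℕ.+-comm k 1))

reverse-range : ∀ a d → reverse (range a (suc d)) ≡ a + + d ∷ reverse (range a d)
reverse-range a d = begin
  reverse (range a (suc d))              ≡⟨ cong (λ l → reverse (range a l)) (ℕ.+-comm 1 d) ⟩
  reverse (range a (d ℕ.+ 1))            ≡⟨ cong reverse (range-++ a d 1) ⟩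
  reverse (range a d ++ [ a + + d ])     ≡⟨ List.reverse-++ (range a d) [ a + + d ] ⟩
  a + + d ∷ reverse (range a d)          ∎
  where open ≡-Reasoning

interval-+ : ∀ a L → interval a (a + + L) ≡ range a (suc L)
interval-+ a L rewrite dec-true (a ℤ.≤? a + + L) (ℤ.i≤i+j a (+ L)) =
  cong (λ d → range a (suc ∣ d ∣)) (x+y-x≡y a (+ L))
  where
  x+y-x≡y : ∀ x y → x + y - x ≡ y
  x+y-x≡y = solve-∀

i<i+[1+k] : ∀ i k → i ℤ.< i + + suc k
i<i+[1+k] i k = subst (ℤ._< i + + suc k) (ℤ.+-identityʳ i) (ℤ.+-monoʳ-< i (ℤ.+<+ (s≤s z≤n)))

>⇒≢ : ∀ {x y} → y ℤ.< x → x ≢ y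
>⇒≢ y<x x≡y = ℤ.<⇒≢ y<x (sym x≡y)

range-< : ∀ a p → All (ℤ._< a + + p) (range a p)
range-< a zero    = []
range-< a (suc p) =
  i<i+[1+k] a p ∷ subst (λ b → All (ℤ._< b) (range (a + + 1) p)) (+-pos-+ a 1 p) (range-< (a + + 1) p)

-∣i∣≤i : ∀ i → - + ∣ i ∣ ℤ.≤ i
-∣i∣≤i (+ zero)    = ℤ.≤-refl
-∣i∣≤i (+ suc _)   = ℤ.-≤+
-∣i∣≤i ℤ.-[1+ _ ]  = ℤ.≤-refl

-N+c≤i : ∀ c N i → c ℕ.+ ∣ i ∣ ≤ N → - + N + + c ℤ.≤ i
-N+c≤i c N i c+∣i∣≤N = begin
  - + N + + c               ≤⟨ ℤ.+-monoˡ-≤ (+ c) (ℤ.neg-mono-≤ (ℤ.+≤+ c+∣i∣≤N)) ⟩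
  - + (c ℕ.+ ∣ i ∣) + + c   ≡⟨ cong (λ x → - x + + c) (ℤ.pos-+ c ∣ i ∣) ⟩
  - (+ c + + ∣ i ∣) + + c   ≡⟨ -[x+y]+x≡-y (+ c) (+ ∣ i ∣) ⟩
  - + ∣ i ∣                 ≤⟨ -∣i∣≤i i ⟩
  i                         ∎
  where
  open ℤ.≤-Reasoning
  -[x+y]+x≡-y : ∀ x y → - (x + y) + x ≡ - y
  -[x+y]+x≡-y = solve-∀

-- Simple transpositions and words

Fixes : ℤ → ℤ → Set
Fixes i j = j ≢ i × j ≢ i + + 1

sᵢ-fixes : ∀ {i j} → Fixes i j → sᵢ i j ≡ j
sᵢ-fixes {i} {j} (j≢i , j≢i+1)
  rewrite dec-false (j ℤ.≟ i) j≢i | dec-false (j ℤ.≟ i + + 1) j≢i+1 = refl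

fixes-below : ∀ {i j} → j ℤ.< i → Fixes i j
fixes-below {i} j<i = ℤ.<⇒≢ j<i , ℤ.<⇒≢ (ℤ.<-trans j<i (i<i+[1+k] i 0))

fixes-above : ∀ {i j} → i + + 1 ℤ.< j → Fixes i j
fixes-above {i} i+1<j = >⇒≢ (ℤ.<-trans (i<i+[1+k] i 0) i+1<j) , >⇒≢ i+1<j

Distant : ℤ → ℤ → Set
Distant i i′ = i + + 1 ℤ.< i′ ⊎ i′ + + 1 ℤ.< i

Distant-sym : ∀ {i i′} → Distant i i′ → Distant i′ i
Distant-sym (inj₁ p) = inj₂ p
Distant-sym (inj₂ p) = inj₁ p

distant-fixes : ∀ {i i′} → Distant i i′ → Fixes i′ i × Fixes i′ (i + + 1)
distant-fixes {i} (inj₁ i+1<i′) = fixes-below (ℤ.<-trans (i<i+[1+k] i 0) i+1<i′) , fixes-below i+1<i′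
distant-fixes {i} (inj₂ i′+1<i) = fixes-above i′+1<i , fixes-above (ℤ.<-trans i′+1<i (i<i+[1+k] i 0))

sᵢ-preserves-fixes : ∀ {i i′ j} → Distant i i′ → Fixes i′ j → Fixes i′ (sᵢ i j)
sᵢ-preserves-fixes {i} {i′} {j} d f with j ℤ.≟ i | j ℤ.≟ i + + 1
... | yes refl | _        = proj₂ (distant-fixes d)
... | no _     | yes refl = proj₁ (distant-fixes d)
... | no _     | no _     = f

sᵢ-comm-at : ∀ {i i′ j} → Distant i i′ → Fixes i′ j → sᵢ i (sᵢ i′ j) ≡ sᵢ i′ (sᵢ i j)
sᵢ-comm-at d f = trans (cong (sᵢ _) (sᵢ-fixes f)) (sym (sᵢ-fixes (sᵢ-preserves-fixes d f)))

fixes-either : ∀ {i i′} → Distant i i′ → ∀ j → Fixes i′ j ⊎ Fixes i j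
fixes-either {i} {i′} d j with j ℤ.≟ i′ | j ℤ.≟ i′ + + 1
... | yes refl | _         = inj₂ (proj₁ (distant-fixes (Distant-sym d)))
... | no _     | yes refl  = inj₂ (proj₂ (distant-fixes (Distant-sym d)))
... | no j≢i′  | no j≢i′+1 = inj₁ (j≢i′ , j≢i′+1)

sᵢ-comm : ∀ {i i′} → Distant i i′ → ∀ j → sᵢ i (sᵢ i′ j) ≡ sᵢ i′ (sᵢ i j)
sᵢ-comm d j with fixes-either d j
... | inj₁ f = sᵢ-comm-at d f
... | inj₂ f = sym (sᵢ-comm-at (Distant-sym d) f)

⟦snoc⟧ : ∀ u i j → ⟦ u ++ [ i ] ⟧ j ≡ ⟦ u ⟧ (sᵢ i j)
⟦snoc⟧ []      i j = refl
⟦snoc⟧ (a ∷ u) i j = cong (sᵢ a) (⟦snoc⟧ u i j)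

minList-snoc : ∀ z u i → minList z (u ++ [ i ]) ≡ minList (i ⊓ z) u
minList-snoc z u i = List.foldr-++ _⊓_ z u [ i ]

ascent : List ℤ → ℤ → Bool
ascent u i = does (⟦ u ⟧ i ℤ.<? ⟦ u ⟧ (i + + 1))

ascent-cong : ∀ {u u′} → ⟦ u ⟧ ≗ ⟦ u′ ⟧ → ∀ i → ascent u i ≡ ascent u′ i
ascent-cong e i = cong₂ (λ a b → does (a ℤ.<? b)) (e i) (e (i + + 1))

ascent-snoc : ∀ {i i′} → Distant i i′ → ∀ u → ascent (u ++ [ i′ ]) i ≡ ascent u i
ascent-snoc {i} d u = cong₂ (λ a b → does (a ℤ.<? b))
  (trans (⟦snoc⟧ u _ i) (cong ⟦ u ⟧ (sᵢ-fixes (proj₁ (distant-fixes d)))))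
  (trans (⟦snoc⟧ u _ (i + + 1)) (cong ⟦ u ⟧ (sᵢ-fixes (proj₂ (distant-fixes d)))))

-- samePerm only inspects the window above the least letter, so equivalent
-- words must denote the same permutation and share their least letter.
infix 4 _≋_
record _≋_ (u u′ : List ℤ) : Set where
  field
    ⟦⟧-≗      : ⟦ u ⟧ ≗ ⟦ u′ ⟧
    minList-≡ : ∀ z → minList z u ≡ minList z u′
open _≋_

≋-refl : ∀ {u} → u ≋ u
≋-refl = record { ⟦⟧-≗ = λ _ → refl ; minList-≡ = λ _ → refl }

≋-snoc : ∀ {u u′} → u ≋ u′ → ∀ i → (u ++ [ i ]) ≋ (u′ ++ [ i ])
≋-snoc {u} {u′} e i = record
  { ⟦⟧-≗      = λ j → trans (⟦snoc⟧ u i j) (trans (⟦⟧-≗ e (sᵢ i j)) (sym (⟦snoc⟧ u′ i j)))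
  ; minList-≡ = λ z → trans (minList-snoc z u i) (trans (minList-≡ e (i ⊓ z)) (sym (minList-snoc z u′ i)))
  }

snoc-comm : ∀ {i i′} → Distant i i′ → ∀ u → (u ++ [ i ]) ++ [ i′ ] ≋ (u ++ [ i′ ]) ++ [ i ]
snoc-comm {i} {i′} d u = record
  { ⟦⟧-≗      = λ j → begin
      ⟦ (u ++ [ i ]) ++ [ i′ ] ⟧ j   ≡⟨ ⟦snoc⟧ (u ++ [ i ]) i′ j ⟩
      ⟦ u ++ [ i ] ⟧ (sᵢ i′ j)       ≡⟨ ⟦snoc⟧ u i (sᵢ i′ j) ⟩
      ⟦ u ⟧ (sᵢ i (sᵢ i′ j))         ≡⟨ cong ⟦ u ⟧ (sᵢ-comm d j) ⟩
      ⟦ u ⟧ (sᵢ i′ (sᵢ i j))         ≡⟨ ⟦snoc⟧ u i′ (sᵢ i j) ⟨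
      ⟦ u ++ [ i′ ] ⟧ (sᵢ i j)       ≡⟨ ⟦snoc⟧ (u ++ [ i′ ]) i j ⟨
      ⟦ (u ++ [ i′ ]) ++ [ i ] ⟧ j   ∎
  ; minList-≡ = λ z → begin
      minList z ((u ++ [ i ]) ++ [ i′ ])  ≡⟨ minList-snoc z (u ++ [ i ]) i′ ⟩
      minList (i′ ⊓ z) (u ++ [ i ])       ≡⟨ minList-snoc (i′ ⊓ z) u i ⟩
      minList (i ⊓ (i′ ⊓ z)) u            ≡⟨ cong (λ y → minList y u) (x∙yz≈y∙xz i i′ z) ⟩
      minList (i′ ⊓ (i ⊓ z)) u            ≡⟨ minList-snoc (i ⊓ z) u i′ ⟨
      minList (i ⊓ z) (u ++ [ i′ ])       ≡⟨ minList-snoc z (u ++ [ i′ ]) i ⟨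
      minList z ((u ++ [ i′ ]) ++ [ i ])  ∎
  }
  where
  open ≡-Reasoning
  open import Algebra.Properties.CommutativeSemigroup ℤ.⊓-commutativeSemigroup using (x∙yz≈y∙xz)

allB-cong : ∀ {A : Set} {p q : A → Bool} → p ≗ q → ∀ xs → allB p xs ≡ allB q xs
allB-cong p≗q []       = refl
allB-cong p≗q (x ∷ xs) = cong₂ _∧_ (p≗q x) (allB-cong p≗q xs)

samePerm-cong : ∀ n {u u′} → u ≋ u′ → ∀ v → samePerm n u v ≡ samePerm n u′ v
samePerm-cong n {u} {u′} e v = begin
  allB (eqAt u) (window u)   ≡⟨ cong (λ a → allB (eqAt u) (interval a (+ n))) minimum-≡ ⟩
  allB (eqAt u) (window u′)  ≡⟨ allB-cong (λ j → cong (λ a → does (a ℤ.≟ ⟦ v ⟧ j)) (⟦⟧-≗ e j)) (window u′) ⟩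
  allB (eqAt u′) (window u′) ∎
  where
  open ≡-Reasoning
  eqAt : List ℤ → ℤ → Bool
  eqAt x j = does (⟦ x ⟧ j ℤ.≟ ⟦ v ⟧ j)
  window : List ℤ → List ℤ
  window x = interval (minList (+ 0) (x ++ v)) (+ n)
  minimum-≡ : minList (+ 0) (u ++ v) ≡ minList (+ 0) (u′ ++ v)
  minimum-≡ = trans (List.foldr-++ _⊓_ (+ 0) u v)
    (trans (minList-≡ e _) (sym (List.foldr-++ _⊓_ (+ 0) u′ v)))

-- Commuting and deleting letters of words

module PartialCommutation {A : Set} (_#_ : A → A → Set) where

  data Swap : List A → List A → Set where
    here  : ∀ {x y} zs → x # y → Swap (x ∷ y ∷ zs) (y ∷ x ∷ zs)
    there : ∀ z {xs ys} → Swap xs ys → Swap (z ∷ xs) (z ∷ ys)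

  infix 4 _≃_
  _≃_ : List A → List A → Set
  _≃_ = EqClosure Swap

  swap : ∀ {x y} zs → x # y → x ∷ y ∷ zs ≃ y ∷ x ∷ zs
  swap zs x#y = fwd (here zs x#y) ◅ ε

  ≃-prefix : ∀ ws {xs ys} → xs ≃ ys → ws ++ xs ≃ ws ++ ys
  ≃-prefix ws = EqClosure.gmap (ws ++_) (Swap-prefix ws)
    where
    Swap-prefix : ∀ ws {xs ys} → Swap xs ys → Swap (ws ++ xs) (ws ++ ys)
    Swap-prefix []       s = s
    Swap-prefix (w ∷ ws) s = there w (Swap-prefix ws s)

  move-past : ∀ {x} ys zs → All (_# x) ys → ys ++ x ∷ zs ≃ x ∷ ys ++ zs
  move-past []       zs []            = ε
  move-past (y ∷ ys) zs (y#x ∷ ys#x) = ≃-prefix [ y ] (move-past ys zs ys#x) ◅◅ swap (ys ++ zs) y#x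

  move-block : ∀ xs ys zs → All (λ x → All (_# x) ys) xs → ys ++ xs ++ zs ≃ xs ++ ys ++ zs
  move-block []       ys zs []              = ε
  move-block (x ∷ xs) ys zs (ys#x ∷ ys#xs) =
    move-past ys (xs ++ zs) ys#x ◅◅ ≃-prefix [ x ] (move-block xs ys zs ys#xs)

open PartialCommutation using (Swap; here; there)

≃-map : ∀ {A B : Set} {_#_ : A → A → Set} {_#′_ : B → B → Set} (f : A → B) →
        (∀ x y → x # y → f x #′ f y) →
        ∀ {xs ys} → PartialCommutation._≃_ _#_ xs ys → PartialCommutation._≃_ _#′_ (map f xs) (map f ys)
≃-map f f-indep = EqClosure.gmap (map f) Swap-map
  where
  Swap-map : ∀ {xs ys} → Swap _ xs ys → Swap _ (map f xs) (map f ys)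
  Swap-map (here zs x#y) = here (map f zs) (f-indep _ _ x#y)
  Swap-map (there z s)   = there (f z) (Swap-map s)

data Prune {A : Set} (P : A → Set) : List A → List A → Set where
  []   : Prune P [] []
  keep : ∀ x {xs ys} → Prune P xs ys → Prune P (x ∷ xs) (x ∷ ys)
  drop : ∀ {x xs ys} → P x → Prune P xs ys → Prune P (x ∷ xs) ys

module _ {A : Set} {P : A → Set} where

  Prune-refl : ∀ xs → Prune P xs xs
  Prune-refl []       = []
  Prune-refl (x ∷ xs) = keep x (Prune-refl xs)

  Prune-all : ∀ {xs} → All P xs → Prune P xs []
  Prune-all []         = []
  Prune-all (px ∷ pxs) = drop px (Prune-all pxs)

  Prune-++ : ∀ {xs ys xs′ ys′} → Prune P xs ys → Prune P xs′ ys′ → Prune P (xs ++ xs′) (ys ++ ys′)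
  Prune-++ []          q = q
  Prune-++ (keep x p)  q = keep x (Prune-++ p q)
  Prune-++ (drop px p) q = drop px (Prune-++ p q)

-- Staircases

infix 4 _≫_
_≫_ : ℕ × ℕ → ℕ × ℕ → Set
p ≫ q = 2 ℕ.+ proj₁ q ≤ proj₁ p

open PartialCommutation _≫_ using (_≃_; ≃-prefix; move-block)

-- (s , r) is the entry in row s and column r of the triangle 0 ≤ r ≤ s; it will stand
-- for the factor h_{B+s}(x_{B+r}).
column : ℕ → ℕ → List (ℕ × ℕ)
column k zero    = (k , k) ∷ []
column k (suc d) = (suc d ℕ.+ k , k) ∷ column k d

columns : ℕ → ℕ → List (ℕ × ℕ)
columns k zero    = column k zero
columns k (suc d) = column k (suc d) ++ columns (suc k) d

diagonal : ℕ → ℕ → ℕ → List (ℕ × ℕ)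
diagonal e k zero      = []
diagonal e k (suc len) = (e ℕ.+ k , k) ∷ diagonal e (suc k) len

diagonals : ℕ → ℕ → ℕ → List (ℕ × ℕ)
diagonals zero    k len = diagonal zero k len
diagonals (suc e) k len = diagonal (suc e) k len ++ diagonals e k (suc len)

column-≤ : ∀ k d → All (λ p → proj₁ p ≤ d ℕ.+ k) (column k d)
column-≤ k zero    = ℕ.≤-refl ∷ []
column-≤ k (suc d) = ℕ.≤-refl ∷ All.map (λ p≤ → ℕ.≤-trans p≤ (ℕ.n≤1+n _)) (column-≤ k d)

diagonal-≥ : ∀ e k len → All (λ p → e ℕ.+ k ≤ proj₁ p) (diagonal e k len)
diagonal-≥ e k zero      = []
diagonal-≥ e k (suc len) =
  ℕ.≤-refl ∷ All.map (ℕ.≤-trans (ℕ.+-monoʳ-≤ e (ℕ.n≤1+n k))) (diagonal-≥ e (suc k) len)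

peel-column : ∀ e k len → diagonals e k (suc len) ≃ column k e ++ diagonals e (suc k) len
peel-column zero    k len = ε
peel-column (suc e) k len =
  ≃-prefix (diagonal (suc e) k (suc len)) (peel-column e k (suc len)) ◅◅
  ≃-prefix [ suc e ℕ.+ k , k ] (move-block (column k e) D (diagonals e (suc k) (suc len)) D≫column)
  where
  D : List (ℕ × ℕ)
  D = diagonal (suc e) (suc k) len
  D≫column : All (λ x → All (_≫ x) D) (column k e)
  D≫column = All.map (λ x≤ → All.map (λ ≤y → ℕ.≤-trans (s≤s (s≤s x≤)) (ℕ.≤-trans gap ≤y))
                                     (diagonal-≥ (suc e) (suc k) len))
                     (column-≤ k e)
    where
    gap : 2 ℕ.+ (e ℕ.+ k) ≤ suc e ℕ.+ suc k
    gap = ℕ.≤-reflexive (cong suc (sym (ℕ.+-suc e k)))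

diagonals≃columns : ∀ d k → diagonals d k 1 ≃ columns k d
diagonals≃columns zero    k = ε
diagonals≃columns (suc d) k =
  peel-column (suc d) k 0 ◅◅ ≃-prefix (column k (suc d)) (diagonals≃columns d (suc k))

-- Coefficients of ordered products of h-factors

sort-≡⇒∈ : ∀ {x xs ys} → sort xs ≡ sort ys → x ∈ xs → x ∈ ys
sort-≡⇒∈ {x} {xs} {ys} eq x∈xs =
  ∈-resp-↭ (sort-↭ ys) (subst (x ∈_) eq (∈-resp-↭ (↭-sym (sort-↭ xs)) x∈xs))

insert-comm : ∀ a b xs → insert a (insert b xs) ≡ insert b (insert a xs)
insert-comm a b xs = Pointwise-≡⇒≡ (insert-swap a b xs)

module Coefficients {c ℓ} (R : CommutativeRing c ℓ) (β : CommutativeRing.Carrier R) (n : ℕ) (m w : List ℤ) where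
  open IdCox R β n
  open CommutativeRing R
    using (Carrier; 0#; 1#; _≈_; setoid; +-identityˡ; +-identityʳ; +-assoc; +-cong; +-congˡ; *-congˡ;
           +-commutativeSemigroup)
    renaming (_+_ to _⊕_; refl to ≈-refl; sym to ≈-sym; trans to ≈-trans)
  open import Relation.Binary.Reasoning.Setoid setoid
  open import Algebra.Properties.CommutativeSemigroup +-commutativeSemigroup using (interchange)

  matches : Term → Bool
  matches t = sameMono (mono t) m ∧ samePerm n (word t) w

  contribution : Term → Carrier
  contribution t = if matches t then coef t else 0#

  -- The coefficient of x^m π_w in  t · h_{i₁}(x_{k₁}) ⋯ h_{iᵣ}(x_{kᵣ}).
  coeffAfter : List (ℤ × ℤ) → Term → Carrier
  coeffAfter []             t = contribution t
  coeffAfter ((i , k) ∷ fs) t = coeffAfter fs t ⊕ coeffAfter fs (termTimes i k t)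

  ∑ : Elem → (Term → Carrier) → Carrier
  ∑ E f = foldr (λ t s → f t ⊕ s) 0# E

  coeff≈∑contribution : ∀ E → coeff m w E ≈ ∑ E contribution
  coeff≈∑contribution []      = ≈-refl
  coeff≈∑contribution (t ∷ E) with matches t
  ... | true  = +-congˡ (coeff≈∑contribution E)
  ... | false = ≈-trans (coeff≈∑contribution E) (≈-sym (+-identityˡ _))

  ∑-++ : ∀ E F f → ∑ (E ++ F) f ≈ ∑ E f ⊕ ∑ F f
  ∑-++ []      F f = ≈-sym (+-identityˡ _)
  ∑-++ (t ∷ E) F f = ≈-trans (+-congˡ (∑-++ E F f)) (≈-sym (+-assoc _ _ _))

  ∑-+ : ∀ E f g → ∑ E f ⊕ ∑ E g ≈ ∑ E (λ t → f t ⊕ g t)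
  ∑-+ []      f g = +-identityˡ _
  ∑-+ (t ∷ E) f g = ≈-trans (interchange _ _ _ _) (+-congˡ (∑-+ E f g))

  coeff-foldl : ∀ fs E → coeff m w (foldl timesH E fs) ≈ ∑ E (coeffAfter fs)
  coeff-foldl []             E = coeff≈∑contribution E
  coeff-foldl ((i , k) ∷ fs) E = begin
    coeff m w (foldl timesH (E ++ map (termTimes i k) E) fs)       ≈⟨ coeff-foldl fs _ ⟩
    ∑ (E ++ map (termTimes i k) E) (coeffAfter fs)                  ≈⟨ ∑-++ E _ _ ⟩
    ∑ E (coeffAfter fs) ⊕ ∑ (map (termTimes i k) E) (coeffAfter fs)
      ≡⟨ cong (_ ⊕_) (List.foldr-map _ _ 0# E) ⟩
    ∑ E (coeffAfter fs) ⊕ ∑ E (λ t → coeffAfter fs (termTimes i k t)) ≈⟨ ∑-+ E _ _ ⟩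
    ∑ E (coeffAfter ((i , k) ∷ fs))                                 ∎

  coeff-prodH : ∀ fs → coeff m w (prodH fs) ≈ coeffAfter fs (term 1# [] [])
  coeff-prodH fs = ≈-trans (coeff-foldl fs one) (+-identityʳ _)

  infix 4 _≅_
  record _≅_ (fs gs : List (ℤ × ℤ)) : Set (c ⊔ ℓ) where
    constructor mk≅
    field coeffAfter-≈ : ∀ t → coeffAfter fs t ≈ coeffAfter gs t
  open _≅_ public

  ≅-isEquivalence : IsEquivalence _≅_
  ≅-isEquivalence = record
    { refl  = mk≅ λ t → ≈-refl
    ; sym   = λ e → mk≅ λ t → ≈-sym (coeffAfter-≈ e t)
    ; trans = λ e e′ → mk≅ λ t → ≈-trans (coeffAfter-≈ e t) (coeffAfter-≈ e′ t)
    }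

  ≅-cons : ∀ f {fs gs} → fs ≅ gs → f ∷ fs ≅ f ∷ gs
  ≅-cons (i , k) e = mk≅ λ t → +-cong (coeffAfter-≈ e t) (coeffAfter-≈ e (termTimes i k t))

  infix 4 _~_
  record _~_ (t t′ : Term) : Set ℓ where
    field
      coef-≈   : coef t ≈ coef t′
      sort-≡   : sort (mono t) ≡ sort (mono t′)
      word-≋   : word t ≋ word t′
  open _~_

  contribution-cong : ∀ {t t′} → t ~ t′ → contribution t ≈ contribution t′
  contribution-cong {t} {t′} e with matches t | matches t′ | matches-≡
    where
    matches-≡ : matches t ≡ matches t′
    matches-≡ = cong₂ _∧_ (cong (λ s → does (≡-dec ℤ._≟_ s (sort m))) (sort-≡ e))
                          (samePerm-cong n (word-≋ e) w)
  ... | true  | .true  | refl = coef-≈ e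
  ... | false | .false | refl = ≈-refl

  termTimes-cong : ∀ i k {t t′} → t ~ t′ → termTimes i k t ~ termTimes i k t′
  termTimes-cong i k {term a mo u} {term a′ mo′ u′} e
    with ascent u i | ascent u′ i | ascent-cong {u} {u′} (⟦⟧-≗ (word-≋ e)) i
  ... | true  | .true  | refl = record
    { coef-≈ = coef-≈ e ; sort-≡ = cong (insert k) (sort-≡ e) ; word-≋ = ≋-snoc (word-≋ e) i }
  ... | false | .false | refl = record
    { coef-≈ = *-congˡ (coef-≈ e) ; sort-≡ = cong (insert k) (sort-≡ e) ; word-≋ = word-≋ e }

  coeffAfter-cong : ∀ {t t′} → t ~ t′ → ∀ fs → coeffAfter fs t ≈ coeffAfter fs t′
  coeffAfter-cong e []             = contribution-cong e
  coeffAfter-cong e ((i , k) ∷ fs) = +-cong (coeffAfter-cong e fs) (coeffAfter-cong (termTimes-cong i k e) fs)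

  swap-variables : ∀ a b x mo u → term x (b ∷ a ∷ mo) u ~ term x (a ∷ b ∷ mo) u
  swap-variables a b x mo u = record { coef-≈ = ≈-refl ; sort-≡ = insert-comm b a (sort mo) ; word-≋ = ≋-refl }

  termTimes-comm : ∀ {i i′} → Distant i i′ → ∀ a b t →
                   termTimes i′ b (termTimes i a t) ~ termTimes i a (termTimes i′ b t)
  termTimes-comm {i} {i′} d a b (term x mo u) with ascent u i in asc | ascent u i′ in asc′
  ... | true | true rewrite ascent-snoc (Distant-sym d) u | ascent-snoc d u | asc | asc′ =
    record { coef-≈ = ≈-refl ; sort-≡ = insert-comm b a (sort mo) ; word-≋ = snoc-comm d u }
  ... | true  | false rewrite ascent-snoc (Distant-sym d) u | asc | asc′ = swap-variables a b _ mo _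
  ... | false | true  rewrite ascent-snoc d u | asc | asc′ = swap-variables a b _ mo _
  ... | false | false rewrite asc | asc′ = swap-variables a b _ mo u

  mono-termTimes : ∀ i k t → mono (termTimes i k t) ≡ k ∷ mono t
  mono-termTimes i k (term a mo u) with ascent u i
  ... | true  = refl
  ... | false = refl

  contribution-vanishes : ∀ {k t} → k ∈ mono t → k ∉ m → contribution t ≈ 0#
  contribution-vanishes {k} {t} k∈t k∉m
    rewrite dec-false (≡-dec ℤ._≟_ (sort (mono t)) (sort m)) (λ eq → k∉m (sort-≡⇒∈ eq k∈t)) = ≈-refl

  coeffAfter-vanishes : ∀ {k t} → k ∈ mono t → k ∉ m → ∀ fs → coeffAfter fs t ≈ 0#
  coeffAfter-vanishes {t = t} k∈t k∉m [] = contribution-vanishes {t = t} k∈t k∉m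
  coeffAfter-vanishes {k} {t} k∈t k∉m ((i , k′) ∷ fs) = ≈-trans
    (+-cong (coeffAfter-vanishes k∈t k∉m fs)
            (coeffAfter-vanishes (subst (k ∈_) (sym (mono-termTimes i k′ t)) (there k∈t)) k∉m fs))
    (+-identityˡ _)

  Prune⇒≅ : ∀ {P : ℤ × ℤ → Set} → (∀ f → P f → proj₂ f ∉ m) → ∀ {fs gs} → Prune P fs gs → fs ≅ gs
  Prune⇒≅ P⇒∉ []         = IsEquivalence.refl ≅-isEquivalence
  Prune⇒≅ P⇒∉ (keep f p) = ≅-cons f (Prune⇒≅ P⇒∉ p)
  Prune⇒≅ P⇒∉ (drop {i , k} {fs} pf p) = mk≅ λ t → ≈-trans
    (+-cong (coeffAfter-≈ (Prune⇒≅ P⇒∉ p) t)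
            (coeffAfter-vanishes (subst (k ∈_) (sym (mono-termTimes i k t)) (here refl)) (P⇒∉ _ pf) fs))
    (+-identityʳ _)

  Swap⇒≅ : ∀ {fs gs} → Swap (Distant on proj₁) fs gs → fs ≅ gs
  Swap⇒≅ (here {i , a} {i′ , b} zs d) = mk≅ λ t → begin
    (A t ⊕ A (q t)) ⊕ (A (p t) ⊕ A (q (p t))) ≈⟨ interchange _ _ _ _ ⟩
    (A t ⊕ A (p t)) ⊕ (A (q t) ⊕ A (q (p t)))
      ≈⟨ +-congˡ (+-congˡ (coeffAfter-cong (termTimes-comm d a b t) zs)) ⟩
    (A t ⊕ A (p t)) ⊕ (A (q t) ⊕ A (p (q t))) ∎
    where
    A : Term → Carrier
    A = coeffAfter zs
    p q : Term → Term
    p = termTimes i a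
    q = termTimes i′ b
  Swap⇒≅ (there f s) = ≅-cons f (Swap⇒≅ s)

  ≃⇒≅ : ∀ {fs gs} → PartialCommutation._≃_ (Distant on proj₁) fs gs → fs ≅ gs
  ≃⇒≅ = EqClosure.fold ≅-isEquivalence Swap⇒≅

-- The truncated products as staircases

module Truncation {c ℓ} (R : CommutativeRing c ℓ) (β : CommutativeRing.Carrier R) (n′ N : ℕ) where
  open IdCox R β (suc n′) using (factorsA)
  open ≡-Reasoning

  B : ℤ
  B = - + N + + n′

  embed : ℕ × ℕ → ℤ × ℤ
  embed (s , r) = (B + + s , B + + r)

  embed-distant : ∀ p q → p ≫ q → (Distant on proj₁) (embed p) (embed q)
  embed-distant (s , _) (s′ , _) 2+s′≤s =
    inj₂ (subst (ℤ._< B + + s) (sym (+-pos-suc B s′)) (ℤ.+-monoʳ-< B (ℤ.+<+ 2+s′≤s)))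

  columns≃diagonals :
    PartialCommutation._≃_ (Distant on proj₁) (map embed (columns 0 N)) (map embed (diagonals N 0 1))
  columns≃diagonals = ≃-map embed embed-distant (EqClosure.symmetric (Swap _≫_) (diagonals≃columns N 0))

  Below : ℤ × ℤ → Set
  Below f = proj₂ f ℤ.< B

  window : interval (- + N) (+ n′) ≡ range (- + N) (n′ ℕ.+ suc N)
  window = begin
    interval (- + N) (+ n′)                  ≡⟨ cong (interval (- + N)) top ⟩
    interval (- + N) (- + N + + (n′ ℕ.+ N))  ≡⟨ interval-+ (- + N) (n′ ℕ.+ N) ⟩
    range (- + N) (suc (n′ ℕ.+ N))           ≡⟨ cong (range (- + N)) (sym (ℕ.+-suc n′ N)) ⟩
    range (- + N) (n′ ℕ.+ suc N)             ∎
    where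
    y≡-x+[y+x] : ∀ x y → y ≡ - x + (y + x)
    y≡-x+[y+x] = solve-∀
    top : + n′ ≡ - + N + + (n′ ℕ.+ N)
    top = trans (y≡-x+[y+x] (+ N) (+ n′)) (cong (λ x → - + N + x) (sym (ℤ.pos-+ n′ N)))

  reverse-column : ∀ k d →
    map (λ i → (i , B + + k)) (reverse (range (B + + k) (suc d))) ≡ map embed (column k d)
  reverse-column k zero    = refl
  reverse-column k (suc d) = trans (cong (map (λ i → (i , B + + k))) (reverse-range (B + + k) (suc d)))
    (cong₂ _∷_ (cong (_, B + + k) top-row) (reverse-column k d))
    where
    top-row : B + + k + + suc d ≡ B + + (suc d ℕ.+ k)
    top-row = trans (+-pos-+ B k (suc d)) (cong (λ x → B + + x) (ℕ.+-comm k (suc d)))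

  factorsA-column : ∀ k d → k ℕ.+ d ≡ N → factorsA (B + + k) ≡ map embed (column k d)
  factorsA-column k d k+d≡N = begin
    map (λ i → (i , B + + k)) (reverse (interval (B + + k) (+ n′)))
      ≡⟨ cong (λ b → map (λ i → (i , B + + k)) (reverse (interval (B + + k) b))) top ⟩
    map (λ i → (i , B + + k)) (reverse (interval (B + + k) (B + + k + + d)))
      ≡⟨ cong (λ l → map (λ i → (i , B + + k)) (reverse l)) (interval-+ (B + + k) d) ⟩
    map (λ i → (i , B + + k)) (reverse (range (B + + k) (suc d)))
      ≡⟨ reverse-column k d ⟩
    map embed (column k d) ∎
    where
    y≡-x+y+x : ∀ x y → y ≡ - x + y + x
    y≡-x+y+x = solve-∀
    top : + n′ ≡ B + + k + + d
    top = trans (y≡-x+y+x (+ N) (+ n′)) (trans (cong (λ x → B + + x) (sym k+d≡N)) (sym (+-pos-+ B k d)))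

  columns-factors : ∀ k d → k ℕ.+ d ≡ N →
    concatMap factorsA (range (B + + k) (suc d)) ≡ map embed (columns k d)
  columns-factors k zero    k+0≡N = trans (List.++-identityʳ _) (factorsA-column k 0 k+0≡N)
  columns-factors k (suc d) k+d≡N = begin
    factorsA (B + + k) ++ concatMap factorsA (range (B + + k + + 1) (suc d))
      ≡⟨ cong₂ _++_ (factorsA-column k (suc d) k+d≡N)
                    (cong (λ a → concatMap factorsA (range a (suc d))) (+-pos-suc B k)) ⟩
    map embed (column k (suc d)) ++ concatMap factorsA (range (B + + suc k) (suc d))
      ≡⟨ cong (map embed (column k (suc d)) ++_)
              (columns-factors (suc k) d (trans (sym (ℕ.+-suc k d)) k+d≡N)) ⟩
    map embed (column k (suc d)) ++ map embed (columns (suc k) d)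
      ≡⟨ List.map-++ embed (column k (suc d)) (columns (suc k) d) ⟨
    map embed (columns k (suc d)) ∎

  lhsFactors : List (ℤ × ℤ)
  lhsFactors = concatMap factorsA (interval (- + N) (+ n′))

  lhs-prune : Prune Below lhsFactors (map embed (columns 0 N))
  lhs-prune = subst (λ fs → Prune Below fs (map embed (columns 0 N))) (sym split)
    (Prune-++ (Prune-all (All.concat⁺ (All.map⁺ (All.map factorsA-below (range-< (- + N) n′)))))
              (Prune-refl (map embed (columns 0 N))))
    where
    factorsA-below : ∀ {a} → a ℤ.< B → All Below (factorsA a)
    factorsA-below a<B = All.map⁺ (All.universal (λ _ → a<B) _)
    split : concatMap factorsA (interval (- + N) (+ n′)) ≡
            concatMap factorsA (range (- + N) n′) ++ map embed (columns 0 N)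
    split = begin
      concatMap factorsA (interval (- + N) (+ n′))
        ≡⟨ cong (concatMap factorsA) (trans window (range-++ (- + N) n′ (suc N))) ⟩
      concatMap factorsA (range (- + N) n′ ++ range B (suc N))
        ≡⟨ List.concatMap-++ factorsA (range (- + N) n′) (range B (suc N)) ⟩
      concatMap factorsA (range (- + N) n′) ++ concatMap factorsA (range B (suc N))
        ≡⟨ cong (λ a → concatMap factorsA (range (- + N) n′) ++ concatMap factorsA (range a (suc N)))
                (sym (ℤ.+-identityʳ B)) ⟩
      concatMap factorsA (range (- + N) n′) ++ concatMap factorsA (range (B + + 0) (suc N))
        ≡⟨ cong (concatMap factorsA (range (- + N) n′) ++_) (columns-factors 0 N refl) ⟩
      concatMap factorsA (range (- + N) n′) ++ map embed (columns 0 N) ∎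

  rhsBlock : ℤ → List (ℤ × ℤ)
  rhsBlock j = map (λ i → (i , i + j)) (interval (- + N) (+ n′))

  diagonal-factors : ∀ e k len →
    map (λ i → (i , i + - + e)) (range (B + + e + + k) len) ≡ map embed (diagonal e k len)
  diagonal-factors e k zero      = refl
  diagonal-factors e k (suc len) = cong₂ _∷_
    (cong₂ _,_ (+-pos-+ B e k) (b+x+y-x≡b+y B (+ e) (+ k)))
    (trans (cong (λ a → map (λ i → (i , i + - + e)) (range a len)) (+-pos-suc (B + + e) k))
           (diagonal-factors e (suc k) len))
    where
    b+x+y-x≡b+y : ∀ b x y → b + x + y + - x ≡ b + y
    b+x+y-x≡b+y = solve-∀

  rhsBlock-prune : ∀ e len → e ℕ.+ len ≡ suc N →
    Prune Below (rhsBlock (- + e)) (map embed (diagonal e 0 len))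
  rhsBlock-prune e len e+len≡1+N = subst (λ fs → Prune Below fs (map embed (diagonal e 0 len))) (sym split)
    (Prune-++ (Prune-all (All.map⁺ (All.map shifted-below (range-< (- + N) (n′ ℕ.+ e)))))
              (Prune-refl (map embed (diagonal e 0 len))))
    where
    f : ℤ → ℤ × ℤ
    f i = (i , i + - + e)
    a+[b+c]-c≡a+b : ∀ a b c → a + (b + c) + - c ≡ a + b
    a+[b+c]-c≡a+b = solve-∀
    shifted-below : ∀ {i} → i ℤ.< - + N + + (n′ ℕ.+ e) → Below (f i)
    shifted-below i< = subst (_ ℤ.<_) shift (ℤ.+-monoˡ-< (- + e) i<)
      where
      shift : - + N + + (n′ ℕ.+ e) + - + e ≡ B
      shift = trans (cong (λ x → - + N + x + - + e) (ℤ.pos-+ n′ e)) (a+[b+c]-c≡a+b (- + N) (+ n′) (+ e))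
    split : rhsBlock (- + e) ≡ map f (range (- + N) (n′ ℕ.+ e)) ++ map embed (diagonal e 0 len)
    split = begin
      map f (interval (- + N) (+ n′))
        ≡⟨ cong (map f) (trans window (cong (range (- + N)) length)) ⟩
      map f (range (- + N) (n′ ℕ.+ e ℕ.+ len))
        ≡⟨ cong (map f) (range-++ (- + N) (n′ ℕ.+ e) len) ⟩
      map f (range (- + N) (n′ ℕ.+ e) ++ range (- + N + + (n′ ℕ.+ e)) len)
        ≡⟨ List.map-++ f (range (- + N) (n′ ℕ.+ e)) _ ⟩
      map f (range (- + N) (n′ ℕ.+ e)) ++ map f (range (- + N + + (n′ ℕ.+ e)) len)
        ≡⟨ cong (λ a → map f (range (- + N) (n′ ℕ.+ e)) ++ map f (range a len)) start ⟩
      map f (range (- + N) (n′ ℕ.+ e)) ++ map f (range (B + + e + + 0) len)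
        ≡⟨ cong (map f (range (- + N) (n′ ℕ.+ e)) ++_) (diagonal-factors e 0 len) ⟩
      map f (range (- + N) (n′ ℕ.+ e)) ++ map embed (diagonal e 0 len) ∎
      where
      length : n′ ℕ.+ suc N ≡ n′ ℕ.+ e ℕ.+ len
      length = trans (cong (n′ ℕ.+_) (sym e+len≡1+N)) (sym (ℕ.+-assoc n′ e len))
      start : - + N + + (n′ ℕ.+ e) ≡ B + + e + + 0
      start = sym (trans (ℤ.+-identityʳ _) (+-pos-+ (- + N) n′ e))

  rhs-prune-from : ∀ e len → e ℕ.+ len ≡ suc N →
    Prune Below (concatMap rhsBlock (range (- + e) (suc e))) (map embed (diagonals e 0 len))
  rhs-prune-from zero len len≡1+N =
    subst (λ fs → Prune Below fs (map embed (diagonal 0 0 len)))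
          (sym (List.++-identityʳ (rhsBlock (+ 0)))) (rhsBlock-prune 0 len len≡1+N)
  rhs-prune-from (suc e) len 1+e+len≡1+N =
    subst₂ (Prune Below) (cong (λ a → rhsBlock (- + suc e) ++ concatMap rhsBlock (range a (suc e))) (sym next))
                         (sym (List.map-++ embed (diagonal (suc e) 0 len) (diagonals e 0 (suc len))))
      (Prune-++ (rhsBlock-prune (suc e) len 1+e+len≡1+N)
                (rhs-prune-from e (suc len) (trans (ℕ.+-suc e len) 1+e+len≡1+N)))
    where
    -[1+x]+1≡-x : ∀ x → - (+ 1 + x) + + 1 ≡ - x
    -[1+x]+1≡-x = solve-∀
    next : - + suc e + + 1 ≡ - + e
    next = trans (cong (λ x → - x + + 1) (ℤ.pos-+ 1 e)) (-[1+x]+1≡-x (+ e))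

  rhsFactors : List (ℤ × ℤ)
  rhsFactors = concatMap rhsBlock (interval (- + N) (+ 0))

  rhs-prune : Prune Below rhsFactors (map embed (diagonals N 0 1))
  rhs-prune = subst (λ xs → Prune Below (concatMap rhsBlock xs) (map embed (diagonals N 0 1))) (sym full)
                    (rhs-prune-from N 1 (ℕ.+-comm N 1))
    where
    full : interval (- + N) (+ 0) ≡ range (- + N) (suc N)
    full = trans (cong (interval (- + N)) (sym (ℤ.+-inverseˡ (+ N)))) (interval-+ (- + N) N)

proposition3p2 : ∀ {c ℓ} (R : CommutativeRing c ℓ) (β : CommutativeRing.Carrier R)
    (n : ℕ) → 1 ≤ n →
    (m : List ℤ) → All (_<ℤ + n) m →
    (w : List ℤ) → All (_<ℤ + n) w →
    ∃ λ N₀ → ∀ N → N₀ ≤ N →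
      CommutativeRing._≈_ R (IdCox.coeff R β n m w (IdCox.lhs R β n N))
                            (IdCox.coeff R β n m w (IdCox.rhs R β n N))
-- The truncations agree in every coefficient, so the bounds on the letters of m and w
-- are not needed.
proposition3p2 R β (suc n′) _ m _ w _ = n′ ℕ.+ ∣ min (+ 0) m ∣ , agree
  where
  open IdCox R β (suc n′) using (Term; term; coeff; lhs; rhs)
  open CommutativeRing R using (1#; setoid; _≈_)
  open import Relation.Binary.Reasoning.Setoid setoid
  open Coefficients R β (suc n′) m w

  agree : ∀ N → n′ ℕ.+ ∣ min (+ 0) m ∣ ≤ N → coeff m w (lhs N) ≈ coeff m w (rhs N)
  agree N N₀≤N = begin
    coeff m w (lhs N)                               ≈⟨ coeff-prodH lhsFactors ⟩
    coeffAfter lhsFactors t₀                        ≈⟨ coeffAfter-≈ (Prune⇒≅ irrelevant lhs-prune) t₀ ⟩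
    coeffAfter (map embed (columns 0 N)) t₀         ≈⟨ coeffAfter-≈ (≃⇒≅ columns≃diagonals) t₀ ⟩
    coeffAfter (map embed (diagonals N 0 1)) t₀     ≈⟨ coeffAfter-≈ (Prune⇒≅ irrelevant rhs-prune) t₀ ⟨
    coeffAfter rhsFactors t₀                        ≈⟨ coeff-prodH rhsFactors ⟨
    coeff m w (rhs N)                               ∎
    where
    open Truncation R β n′ N
    t₀ : Term
    t₀ = term 1# [] []
    irrelevant : ∀ f → Below f → proj₂ f ∉ m
    irrelevant _ below k∈m = ℤ.<⇒≱ below
      (ℤ.≤-trans (-N+c≤i n′ N (min (+ 0) m) N₀≤N) (All.lookup (min≤xs (+ 0) m) k∈m))
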